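{- Let $n,m,r,p$ be nonnegative integers and $y$ complex. Then \[ w_{n+m}^{(r)}(y)=\sum_{k=0}^{m}\left\{{m+r\atop k+r}\right\}_{r}(r)_{k}(-1)^{m+k}(y+1)^{k}\,w_{n}^{(r+k)}(y). \] Moreover, if $r\geq1$ and $y\neq-1$, then \[ w_{n}^{(r+p)}(y)=\frac{1}{(r)_{p}(1+y)^{p}}\sum_{k=0}^{p}\left[{p+r\atop k+r}\right]_{r}w_{n+k}^{(r)}(y). \]
   Context: For real $s\ge0$, $w_{n}^{(s)}(y)=\sum_{k=0}^{n}\left\{{n\atop k}\right\}(s)_{k}\,y^{k}$, where $\left\{{n\atop k}\right\}$ are Stirling numbers of the second kind and $(x)_{k}=x(x+1)\cdots(x+k-1)$, $(x)_0=1$. The $r$-Stirling numbers of the second kind are defined by $\frac{(e^{t}-1)^{k}e^{rt}}{k!}=\sum_{n\geq k}\left\{{n+r\atop k+r}\right\}_{r}\frac{t^{n}}{n!}$ (zero for $k>n$). The $r$-Stirling numbers of the first kind are defined by $(x+r)(x+r+1)\cdots(x+r+p-1)=\sum_{k=0}^{p}\left[{p+r\atop k+r}\right]_{r}x^{k}$. -}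

module Defs where

open import Level using (Level)
open import Data.Nat as ℕ using (ℕ; zero; suc)
open import Data.Nat.Combinatorics using (_C_)
open import Algebra.Bundles using (CommutativeRing)

S2 : ℕ → ℕ → ℕ
S2 zero    zero    = 1
S2 zero    (suc k) = 0
S2 (suc n) zero    = 0
S2 (suc n) (suc k) = suc k ℕ.* S2 n (suc k) ℕ.+ S2 n k

sumℕ : ℕ → (ℕ → ℕ) → ℕ
sumℕ zero    f = f 0
sumℕ (suc n) f = sumℕ n f ℕ.+ f (suc n)

-- r-Stirling numbers of the second kind:  rS2 r n k = {n+r , k+r}_r.
-- Defined as the coefficient of t^n/n! in ((e^t-1)^k/k!) * e^{rt}, i.e.
-- the binomial convolution of the egfs  Σ S2 i k t^i/i!  and  Σ r^j t^j/j!.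
rS2 : ℕ → ℕ → ℕ → ℕ
rS2 r n k = sumℕ n (λ i → (n C i) ℕ.* S2 i k ℕ.* (r ℕ.^ (n ℕ.∸ i)))

-- r-Stirling numbers of the first kind:  rS1 r p k = [p+r , k+r]_r,
-- the coefficient of x^k in (x+r)(x+r+1)...(x+r+p-1), computed by
-- multiplying in one linear factor (x + r + p) at a time.
rS1 : ℕ → ℕ → ℕ → ℕ
rS1 r zero    zero    = 1
rS1 r zero    (suc k) = 0
rS1 r (suc p) zero    = (r ℕ.+ p) ℕ.* rS1 r p zero
rS1 r (suc p) (suc k) = (r ℕ.+ p) ℕ.* rS1 r p (suc k) ℕ.+ rS1 r p k

module WithRing {c ℓ : Level} (R : CommutativeRing c ℓ) where
  open CommutativeRing R

  ι : ℕ → Carrier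
  ι zero    = 0#
  ι (suc n) = 1# + ι n

  pow : Carrier → ℕ → Carrier
  pow x zero    = 1#
  pow x (suc k) = x * pow x k

  rising : Carrier → ℕ → Carrier
  rising x zero    = 1#
  rising x (suc k) = rising x k * (x + ι k)

  sgn : ℕ → Carrier
  sgn k = pow (- 1#) k

  sumR : ℕ → (ℕ → Carrier) → Carrier
  sumR zero    f = f 0
  sumR (suc n) f = sumR n f + f (suc n)

  w : ℕ → ℕ → Carrier → Carrier
  w n s y = sumR n (λ k → ι (S2 n k) * rising (ι s) k * pow y k)

{-# OPTIONS --safe #-}

-- Everything rests on one summation-by-parts identity for coefficient
-- triangles obeying a Pascal-type recurrence b(k+1) = a(k) + α(k+1) a(k+1),
-- which binomial coefficients, {n k} and both kinds of r-Stirling numbers do.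
-- For {n k} it yields the contiguity relation
--   w_{n+1}^{(s)} + s w_n^{(s)} = s (1+y) w_n^{(s+1)},
-- i.e. ŵ_k(n) = (r)_k (1+y)^k w_n^{(r+k)} satisfies ŵ_{k+1}(n) = ŵ_k(n+1) + (r+k) ŵ_k(n).
-- Both expansions then follow by induction, on m (raising n) and on p
-- (raising the parameter), each inductive step being the same identity
-- applied to the recurrence of the r-Stirling numbers.

module Submission where

open import Defs
open import Level using (Level)
open import Data.Nat as ℕ using (ℕ; zero; suc; _≥_; _≤_; _<_; z≤n; s≤s)
import Data.Nat.Properties as ℕₚ
open import Data.Nat.Combinatorics using (_C_; nCk+nC[k+1]≡[n+1]C[k+1]; k>n⇒nCk≡0)
open import Data.Product using (_×_; _,_)
open import Algebra.Bundles using (CommutativeRing)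
import Relation.Binary.PropositionalEquality as ≡

n<k⇒S2≡0 : ∀ {n k} → n < k → S2 n k ≡.≡ 0
n<k⇒S2≡0 {zero}  {suc k} _ = ≡.refl
n<k⇒S2≡0 {suc n} {suc k} (s≤s n<k)
  rewrite n<k⇒S2≡0 (ℕₚ.m≤n⇒m≤1+n n<k) | n<k⇒S2≡0 n<k | ℕₚ.*-zeroʳ k = ≡.refl

p<k⇒rS1≡0 : ∀ r {p k} → p < k → rS1 r p k ≡.≡ 0
p<k⇒rS1≡0 r {zero}  {suc k} _ = ≡.refl
p<k⇒rS1≡0 r {suc p} {suc k} (s≤s p<k)
  rewrite p<k⇒rS1≡0 r (ℕₚ.m≤n⇒m≤1+n p<k) | p<k⇒rS1≡0 r p<k | ℕₚ.*-zeroʳ (r ℕ.+ p) = ≡.refl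

module _ {ℓ₁ ℓ₂ : Level} (R : CommutativeRing ℓ₁ ℓ₂) where
  open CommutativeRing R hiding (zero)
  open WithRing R
  open import Algebra.Properties.Ring ring using (-1*x≈-x; -‿involutive)
  open import Relation.Binary.Reasoning.Setoid setoid
  open import Algebra.Solver.Ring.NaturalCoefficients.Default commutativeSemiring
    using (solve; _:=_; _:+_; _:*_; con)

  ι-homo-+ : ∀ a b → ι (a ℕ.+ b) ≈ ι a + ι b
  ι-homo-+ zero    b = sym (+-identityˡ _)
  ι-homo-+ (suc a) b = trans (+-congˡ (ι-homo-+ a b)) (sym (+-assoc _ _ _))

  ι-homo-* : ∀ a b → ι (a ℕ.* b) ≈ ι a * ι b
  ι-homo-* zero    b = sym (zeroˡ _)
  ι-homo-* (suc a) b = begin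
    ι (b ℕ.+ a ℕ.* b)  ≈⟨ trans (ι-homo-+ b (a ℕ.* b)) (+-congˡ (ι-homo-* a b)) ⟩
    ι b + ι a * ι b    ≈⟨ solve 2 (λ x z → x :+ z :* x := (con 1 :+ z) :* x) refl (ι b) (ι a) ⟩
    (1# + ι a) * ι b   ∎

  ι-homo-^ : ∀ a e → ι (a ℕ.^ e) ≈ pow (ι a) e
  ι-homo-^ a zero    = +-identityʳ 1#
  ι-homo-^ a (suc e) = trans (ι-homo-* a (a ℕ.^ e)) (*-congˡ (ι-homo-^ a e))

  pow-cong : ∀ {x x′} k → x ≈ x′ → pow x k ≈ pow x′ k
  pow-cong zero    x≈x′ = refl
  pow-cong (suc k) x≈x′ = *-cong x≈x′ (pow-cong k x≈x′)

  rising-sucˡ : ∀ x k → rising x (suc k) ≈ x * rising (1# + x) k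
  rising-sucˡ x zero    = solve 1 (λ a → con 1 :* (a :+ con 0) := a :* con 1) refl x
  rising-sucˡ x (suc k) = begin
    rising x (suc k) * (x + ι (suc k))        ≈⟨ *-cong (rising-sucˡ x k)
      (solve 2 (λ a b → a :+ (con 1 :+ b) := (con 1 :+ a) :+ b) refl x (ι k)) ⟩
    x * rising (1# + x) k * ((1# + x) + ι k)  ≈⟨ *-assoc _ _ _ ⟩
    x * rising (1# + x) (suc k)               ∎

  sgn-suc-suc : ∀ k → sgn (suc (suc k)) ≈ sgn k
  sgn-suc-suc k = begin
    - 1# * (- 1# * sgn k)  ≈⟨ sym (*-assoc _ _ _) ⟩
    - 1# * - 1# * sgn k    ≈⟨ *-congʳ (trans (-1*x≈-x (- 1#)) (-‿involutive 1#)) ⟩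
    1# * sgn k             ≈⟨ *-identityˡ _ ⟩
    sgn k                  ∎

  ≈+⇒≈-1*+ : ∀ {x y z} → x ≈ y + z → y ≈ x + - 1# * z
  ≈+⇒≈-1*+ {x} {y} {z} x≈y+z = begin
    y               ≈⟨ sym (+-identityʳ y) ⟩
    y + 0#          ≈⟨ +-congˡ (sym (-‿inverseʳ z)) ⟩
    y + (z + - z)   ≈⟨ sym (+-assoc _ _ _) ⟩
    y + z + - z     ≈⟨ +-cong (sym x≈y+z) (sym (-1*x≈-x z)) ⟩
    x + - 1# * z    ∎

  sumR-cong : ∀ n {f g : ℕ → Carrier} → (∀ {i} → i ≤ n → f i ≈ g i) → sumR n f ≈ sumR n g
  sumR-cong zero    f≈g = f≈g z≤n
  sumR-cong (suc n) f≈g = +-cong (sumR-cong n (λ i≤n → f≈g (ℕₚ.m≤n⇒m≤1+n i≤n))) (f≈g ℕₚ.≤-refl)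

  sumR-distrib-+ : ∀ n (f g : ℕ → Carrier) → sumR n (λ i → f i + g i) ≈ sumR n f + sumR n g
  sumR-distrib-+ zero    f g = refl
  sumR-distrib-+ (suc n) f g = trans (+-congʳ (sumR-distrib-+ n f g))
    (solve 4 (λ a b c d → (a :+ b) :+ (c :+ d) := (a :+ c) :+ (b :+ d)) refl _ _ _ _)

  *-distribˡ-sumR : ∀ n x (f : ℕ → Carrier) → x * sumR n f ≈ sumR n (λ i → x * f i)
  *-distribˡ-sumR zero    x f = refl
  *-distribˡ-sumR (suc n) x f = trans (distribˡ x _ _) (+-congʳ (*-distribˡ-sumR n x f))

  sumR-head : ∀ n (f : ℕ → Carrier) → sumR (suc n) f ≈ f 0 + sumR n (λ i → f (suc i))
  sumR-head zero    f = refl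
  sumR-head (suc n) f = trans (+-congʳ (sumR-head n f)) (+-assoc _ _ _)

  ι-homo-sumℕ : ∀ n (f : ℕ → ℕ) → ι (sumℕ n f) ≈ sumR n (λ i → ι (f i))
  ι-homo-sumℕ zero    f = refl
  ι-homo-sumℕ (suc n) f = trans (ι-homo-+ (sumℕ n f) (f (suc n))) (+-congʳ (ι-homo-sumℕ n f))

  sumR-pascal : ∀ n (a b α f : ℕ → Carrier) →
    b 0 ≈ α 0 * a 0 → (∀ k → b (suc k) ≈ a k + α (suc k) * a (suc k)) → a (suc n) ≈ 0# →
    sumR (suc n) (λ k → b k * f k) ≈ sumR n (λ k → a k * (f (suc k) + α k * f k))
  sumR-pascal n a b α f b₀ b-suc a-last = begin
    sumR (suc n) (λ k → b k * f k)
      ≈⟨ sumR-head n _ ⟩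
    b 0 * f 0 + sumR n (λ k → b (suc k) * f (suc k))
      ≈⟨ +-cong (trans (*-congʳ b₀) (*-assoc _ _ _))
                (trans (sumR-cong n (λ _ → split _)) (sumR-distrib-+ n _ _)) ⟩
    α 0 * (a 0 * f 0) + (sumR n (λ k → a k * f (suc k)) + sumR n (λ k → g (suc k)))
      ≈⟨ solve 5 (λ α a f z t → α :* (a :* f) :+ (z :+ t) := z :+ (a :* (α :* f) :+ t)) refl _ _ _ _ _ ⟩
    sumR n (λ k → a k * f (suc k)) + (g 0 + sumR n (λ k → g (suc k)))
      ≈⟨ +-congˡ (sym (sumR-head n g)) ⟩
    sumR n (λ k → a k * f (suc k)) + (sumR n g + g (suc n))
      ≈⟨ +-congˡ (trans (+-congˡ (trans (*-congʳ a-last) (zeroˡ _))) (+-identityʳ _)) ⟩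
    sumR n (λ k → a k * f (suc k)) + sumR n g
      ≈⟨ sym (trans (sumR-cong n (λ _ → distribˡ _ _ _)) (sumR-distrib-+ n _ _)) ⟩
    sumR n (λ k → a k * (f (suc k) + α k * f k)) ∎
    where
    g : ℕ → Carrier
    g k = a k * (α k * f k)
    split : ∀ k → b (suc k) * f (suc k) ≈ a k * f (suc k) + g (suc k)
    split k = trans (*-congʳ (b-suc k))
      (solve 4 (λ x α y z → (x :+ α :* y) :* z := x :* z :+ y :* (α :* z)) refl _ _ _ _)

  binomialConv : Carrier → (ℕ → Carrier) → ℕ → Carrier
  binomialConv x g n = sumR n (λ i → ι (n C i) * g i * pow x (n ℕ.∸ i))

  binomialConv-cong : ∀ x n {g h : ℕ → Carrier} → (∀ {i} → i ≤ n → g i ≈ h i) →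
    binomialConv x g n ≈ binomialConv x h n
  binomialConv-cong x n g≈h = sumR-cong n (λ i≤n → *-congʳ (*-congˡ (g≈h i≤n)))

  binomialConv-+ : ∀ x n (g h : ℕ → Carrier) →
    binomialConv x (λ i → g i + h i) n ≈ binomialConv x g n + binomialConv x h n
  binomialConv-+ x n g h = trans (sumR-cong n (λ _ → trans (*-congʳ (distribˡ _ _ _)) (distribʳ _ _ _)))
                                 (sumR-distrib-+ n _ _)

  binomialConv-*ˡ : ∀ x n z (g : ℕ → Carrier) → binomialConv x (λ i → z * g i) n ≈ z * binomialConv x g n
  binomialConv-*ˡ x n z g = trans
    (sumR-cong n (λ _ → solve 4 (λ c z g p → c :* (z :* g) :* p := z :* (c :* g :* p)) refl _ _ _ _))
    (sym (*-distribˡ-sumR n z _))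

  -- On exponential generating functions: (e^{xt} G(t))′ = e^{xt} (G′(t) + x G(t)).
  binomialConv-suc : ∀ x n (g : ℕ → Carrier) →
    binomialConv x g (suc n) ≈ binomialConv x (λ i → g (suc i) + x * g i) n
  binomialConv-suc x n g = begin
    binomialConv x g (suc n)
      ≈⟨ sumR-cong (suc n) (λ _ → *-assoc _ _ _) ⟩
    sumR (suc n) (λ i → ι (suc n C i) * f i)
      ≈⟨ sumR-pascal n (λ i → ι (n C i)) (λ i → ι (suc n C i)) (λ _ → 1#) f
                     (sym (*-identityˡ _)) pascal (reflexive (≡.cong ι (k>n⇒nCk≡0 (ℕₚ.n<1+n n)))) ⟩
    sumR n (λ i → ι (n C i) * (f (suc i) + 1# * f i))
      ≈⟨ sumR-cong n term ⟩
    binomialConv x (λ i → g (suc i) + x * g i) n ∎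
    where
    f : ℕ → Carrier
    f i = g i * pow x (suc n ℕ.∸ i)
    pascal : ∀ k → ι (suc n C suc k) ≈ ι (n C k) + 1# * ι (n C suc k)
    pascal k = trans (reflexive (≡.cong ι (≡.sym (nCk+nC[k+1]≡[n+1]C[k+1] n k))))
                     (trans (ι-homo-+ (n C k) (n C suc k)) (+-congˡ (sym (*-identityˡ _))))
    term : ∀ {i} → i ≤ n →
      ι (n C i) * (f (suc i) + 1# * f i) ≈ ι (n C i) * (g (suc i) + x * g i) * pow x (n ℕ.∸ i)
    term {i} i≤n rewrite ℕₚ.+-∸-assoc 1 i≤n =
      solve 5 (λ c g′ g x p → c :* (g′ :* p :+ con 1 :* (g :* (x :* p))) := c :* (g′ :+ x :* g) :* p)
        refl _ _ _ _ _

  ι-rS2 : ∀ r n k → ι (rS2 r n k) ≈ binomialConv (ι r) (λ i → ι (S2 i k)) n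
  ι-rS2 r n k = trans (ι-homo-sumℕ n _) (sumR-cong n (λ {i} _ →
    trans (ι-homo-* ((n C i) ℕ.* S2 i k) (r ℕ.^ (n ℕ.∸ i)))
          (*-cong (ι-homo-* (n C i) (S2 i k)) (ι-homo-^ r (n ℕ.∸ i)))))

  ι-rS2-suc-zero : ∀ r n → ι (rS2 r (suc n) 0) ≈ ι r * ι (rS2 r n 0)
  ι-rS2-suc-zero r n = begin
    ι (rS2 r (suc n) 0)                          ≈⟨ ι-rS2 r (suc n) 0 ⟩
    binomialConv (ι r) g (suc n)                 ≈⟨ binomialConv-suc (ι r) n g ⟩
    binomialConv (ι r) (λ i → 0# + ι r * g i) n  ≈⟨ binomialConv-cong (ι r) n (λ _ → +-identityˡ _) ⟩
    binomialConv (ι r) (λ i → ι r * g i) n       ≈⟨ binomialConv-*ˡ (ι r) n (ι r) g ⟩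
    ι r * binomialConv (ι r) g n                 ≈⟨ *-congˡ (sym (ι-rS2 r n 0)) ⟩
    ι r * ι (rS2 r n 0)                          ∎
    where
    g : ℕ → Carrier
    g i = ι (S2 i 0)

  ι-rS2-suc-suc : ∀ r n j →
    ι (rS2 r (suc n) (suc j)) ≈ ι (rS2 r n j) + ι (r ℕ.+ suc j) * ι (rS2 r n (suc j))
  ι-rS2-suc-suc r n j = begin
    ι (rS2 r (suc n) (suc j))
      ≈⟨ trans (ι-rS2 r (suc n) (suc j)) (binomialConv-suc x n g) ⟩
    binomialConv x (λ i → ι (S2 (suc i) (suc j)) + x * g i) n
      ≈⟨ binomialConv-cong x n (λ {i} _ → S2-step i) ⟩
    binomialConv x (λ i → h i + ι (r ℕ.+ suc j) * g i) n
      ≈⟨ binomialConv-+ x n h _ ⟩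
    binomialConv x h n + binomialConv x (λ i → ι (r ℕ.+ suc j) * g i) n
      ≈⟨ +-cong (sym (ι-rS2 r n j))
                (trans (binomialConv-*ˡ x n _ g) (*-congˡ (sym (ι-rS2 r n (suc j))))) ⟩
    ι (rS2 r n j) + ι (r ℕ.+ suc j) * ι (rS2 r n (suc j)) ∎
    where
    x = ι r
    g h : ℕ → Carrier
    g i = ι (S2 i (suc j))
    h i = ι (S2 i j)
    S2-step : ∀ i → ι (S2 (suc i) (suc j)) + x * g i ≈ h i + ι (r ℕ.+ suc j) * g i
    S2-step i = begin
      ι (suc j ℕ.* S2 i (suc j) ℕ.+ S2 i j) + x * g i
        ≈⟨ +-congʳ (trans (ι-homo-+ (suc j ℕ.* S2 i (suc j)) _) (+-congʳ (ι-homo-* (suc j) (S2 i (suc j))))) ⟩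
      ι (suc j) * g i + h i + x * g i
        ≈⟨ solve 4 (λ s g h x → s :* g :+ h :+ x :* g := h :+ (x :+ s) :* g) refl _ _ _ _ ⟩
      h i + (x + ι (suc j)) * g i
        ≈⟨ +-congˡ (*-congʳ (sym (ι-homo-+ r (suc j)))) ⟩
      h i + ι (r ℕ.+ suc j) * g i ∎

  ι-rS2-vanishes : ∀ r {m k} → m < k → ι (rS2 r m k) ≈ 0#
  ι-rS2-vanishes r {zero}  {suc k} _         = refl
  ι-rS2-vanishes r {suc m} {suc k} (s≤s m<k) = begin
    ι (rS2 r (suc m) (suc k))                              ≈⟨ ι-rS2-suc-suc r m k ⟩
    ι (rS2 r m k) + ι (r ℕ.+ suc k) * ι (rS2 r m (suc k))  ≈⟨ +-cong (ι-rS2-vanishes r m<k)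
        (trans (*-congˡ (ι-rS2-vanishes r (ℕₚ.m≤n⇒m≤1+n m<k))) (zeroʳ _)) ⟩
    0# + 0#                                                ≈⟨ +-identityʳ 0# ⟩
    0#                                                     ∎

  module _ (y : Carrier) where

    w-contiguity : ∀ n s → w (suc n) s y + ι s * w n s y ≈ ι s * (1# + y) * w n (suc s) y
    w-contiguity n s = begin
      w (suc n) s y + ι s * w n s y
        ≈⟨ +-cong (trans (sumR-cong (suc n) (λ _ → *-assoc _ _ _))
                         (sumR-pascal n a (λ k → ι (S2 (suc n) k)) ι f (sym (zeroˡ _)) S2-rec a-last))
                  (*-distribˡ-sumR n (ι s) _) ⟩
      sumR n (λ k → a k * (f (suc k) + ι k * f k)) + sumR n (λ k → ι s * w-term s k)
        ≈⟨ sym (sumR-distrib-+ n _ _) ⟩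
      sumR n (λ k → a k * (f (suc k) + ι k * f k) + ι s * w-term s k)
        ≈⟨ sumR-cong n (λ {k} _ → term k) ⟩
      sumR n (λ k → ι s * (1# + y) * w-term (suc s) k)
        ≈⟨ sym (*-distribˡ-sumR n _ _) ⟩
      ι s * (1# + y) * w n (suc s) y ∎
      where
      a f : ℕ → Carrier
      a k = ι (S2 n k)
      f k = rising (ι s) k * pow y k
      w-term : ℕ → ℕ → Carrier
      w-term s k = ι (S2 n k) * rising (ι s) k * pow y k
      S2-rec : ∀ k → ι (S2 (suc n) (suc k)) ≈ a k + ι (suc k) * a (suc k)
      S2-rec k = trans (ι-homo-+ (suc k ℕ.* S2 n (suc k)) _) (trans (+-congʳ (ι-homo-* (suc k) (S2 n (suc k)))) (+-comm _ _))
      a-last : a (suc n) ≈ 0#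
      a-last = reflexive (≡.cong ι (n<k⇒S2≡0 (ℕₚ.n<1+n n)))
      term : ∀ k → a k * (f (suc k) + ι k * f k) + ι s * w-term s k ≈ ι s * (1# + y) * w-term (suc s) k
      term k = begin
        a k * (f (suc k) + ι k * f k) + ι s * w-term s k
          ≈⟨ solve 6 (λ a ρ s k y p →
               a :* (ρ :* (s :+ k) :* (y :* p) :+ k :* (ρ :* p)) :+ s :* (a :* ρ :* p)
                 := (con 1 :+ y) :* a :* (ρ :* (s :+ k)) :* p)
               refl (a k) (rising (ι s) k) (ι s) (ι k) y (pow y k) ⟩
        (1# + y) * a k * rising (ι s) (suc k) * pow y k
          ≈⟨ *-congʳ (*-congˡ (rising-sucˡ (ι s) k)) ⟩
        (1# + y) * a k * (ι s * rising (ι (suc s)) k) * pow y k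
          ≈⟨ solve 5 (λ z a s ρ p → z :* a :* (s :* ρ) :* p := s :* z :* (a :* ρ :* p))
               refl (1# + y) (a k) (ι s) (rising (ι (suc s)) k) (pow y k) ⟩
        ι s * (1# + y) * w-term (suc s) k ∎

    ŵ : ℕ → ℕ → ℕ → Carrier
    ŵ r k n = rising (ι r) k * pow (1# + y) k * w n (r ℕ.+ k) y

    ŵ-suc : ∀ r k n → ŵ r (suc k) n ≈ ŵ r k (suc n) + ι (r ℕ.+ k) * ŵ r k n
    ŵ-suc r k n = begin
      rising (ι r) k * (ι r + ι k) * ((1# + y) * pow (1# + y) k) * w n (r ℕ.+ suc k) y
        ≈⟨ *-cong (*-congʳ (*-congˡ (sym (ι-homo-+ r k))))
                  (reflexive (≡.cong (λ t → w n t y) (ℕₚ.+-suc r k))) ⟩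
      rising (ι r) k * ι s * ((1# + y) * pow (1# + y) k) * w n (suc s) y
        ≈⟨ solve 5 (λ ρ s z p v → ρ :* s :* (z :* p) :* v := ρ :* p :* (s :* z :* v)) refl _ _ _ _ _ ⟩
      ρπ * (ι s * (1# + y) * w n (suc s) y)
        ≈⟨ *-congˡ (sym (w-contiguity n s)) ⟩
      ρπ * (w (suc n) s y + ι s * w n s y)
        ≈⟨ solve 4 (λ a b c d → a :* (b :+ c :* d) := a :* b :+ c :* (a :* d)) refl _ _ _ _ ⟩
      ŵ r k (suc n) + ι s * ŵ r k n ∎
      where
      s = r ℕ.+ k
      ρπ = rising (ι r) k * pow (1# + y) k

    ŵ-rS1-expansion : ∀ r p n → ŵ r p n ≈ sumR p (λ k → ι (rS1 r p k) * w (n ℕ.+ k) r y)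
    ŵ-rS1-expansion r zero n = begin
      1# * 1# * w n (r ℕ.+ 0) y  ≈⟨ solve 1 (λ v → con 1 :* con 1 :* v := (con 1 :+ con 0) :* v) refl _ ⟩
      (1# + 0#) * w n (r ℕ.+ 0) y
        ≈⟨ reflexive (≡.cong₂ (λ a b → (1# + 0#) * w a b y) (≡.sym (ℕₚ.+-identityʳ n)) (ℕₚ.+-identityʳ r)) ⟩
      (1# + 0#) * w (n ℕ.+ 0) r y ∎
    ŵ-rS1-expansion r (suc p) n = begin
      ŵ r (suc p) n
        ≈⟨ ŵ-suc r p n ⟩
      ŵ r p (suc n) + ι s * ŵ r p n
        ≈⟨ +-cong (ŵ-rS1-expansion r p (suc n)) (*-congˡ (ŵ-rS1-expansion r p n)) ⟩
      sumR p (λ k → c k * w (suc n ℕ.+ k) r y) + ι s * sumR p (λ k → c k * f k)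
        ≈⟨ +-cong (sumR-cong p (λ {k} _ → *-congˡ (reflexive (≡.cong (λ t → w t r y) (≡.sym (ℕₚ.+-suc n k))))))
                  (*-distribˡ-sumR p (ι s) _) ⟩
      sumR p (λ k → c k * f (suc k)) + sumR p (λ k → ι s * (c k * f k))
        ≈⟨ sym (trans (sumR-cong p (λ _ → solve 4 (λ c f′ s f → c :* (f′ :+ s :* f) := c :* f′ :+ s :* (c :* f))
                                                  refl _ _ _ _))
                      (sumR-distrib-+ p _ _)) ⟩
      sumR p (λ k → c k * (f (suc k) + ι s * f k))
        ≈⟨ sym (sumR-pascal p c (λ k → ι (rS1 r (suc p) k)) (λ _ → ι s) f
                 (ι-homo-* s _) rS1-rec (reflexive (≡.cong ι (p<k⇒rS1≡0 r (ℕₚ.n<1+n p))))) ⟩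
      sumR (suc p) (λ k → ι (rS1 r (suc p) k) * f k) ∎
      where
      s = r ℕ.+ p
      c f : ℕ → Carrier
      c k = ι (rS1 r p k)
      f k = w (n ℕ.+ k) r y
      rS1-rec : ∀ k → ι (rS1 r (suc p) (suc k)) ≈ c k + ι s * c (suc k)
      rS1-rec k = trans (ι-homo-+ (s ℕ.* rS1 r p (suc k)) _) (trans (+-congʳ (ι-homo-* s _)) (+-comm _ _))

    ŵ-rS2-expansion : ∀ m n r → w (n ℕ.+ m) r y ≈ sumR m (λ k → ι (rS2 r m k) * sgn (m ℕ.+ k) * ŵ r k n)
    ŵ-rS2-expansion zero n r = begin
      w (n ℕ.+ 0) r y
        ≈⟨ reflexive (≡.cong₂ (λ a b → w a b y) (ℕₚ.+-identityʳ n) (≡.sym (ℕₚ.+-identityʳ r))) ⟩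
      w n (r ℕ.+ 0) y
        ≈⟨ solve 1 (λ v → v := (con 1 :+ con 0) :* con 1 :* (con 1 :* con 1 :* v)) refl _ ⟩
      (1# + 0#) * 1# * (1# * 1# * w n (r ℕ.+ 0) y) ∎
    ŵ-rS2-expansion (suc m) n r = begin
      w (n ℕ.+ suc m) r y
        ≈⟨ reflexive (≡.cong (λ t → w t r y) (ℕₚ.+-suc n m)) ⟩
      w (suc n ℕ.+ m) r y
        ≈⟨ ŵ-rS2-expansion m (suc n) r ⟩
      sumR m (λ k → a k * ŵ r k (suc n))
        ≈⟨ sumR-cong m (λ {k} _ → *-congˡ (trans (≈+⇒≈-1*+ (ŵ-suc r k n)) (+-congˡ (sym (*-assoc _ _ _))))) ⟩
      sumR m (λ k → a k * (ŵ r (suc k) n + α k * ŵ r k n))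
        ≈⟨ sym (sumR-pascal m a b α (λ k → ŵ r k n) b₀ rS2-rec
                 (trans (*-congʳ (ι-rS2-vanishes r (ℕₚ.n<1+n m))) (zeroˡ _))) ⟩
      sumR (suc m) (λ k → b k * ŵ r k n) ∎
      where
      a b α : ℕ → Carrier
      a k = ι (rS2 r m k) * sgn (m ℕ.+ k)
      b k = ι (rS2 r (suc m) k) * sgn (suc m ℕ.+ k)
      α k = - 1# * ι (r ℕ.+ k)
      b₀ : b 0 ≈ α 0 * a 0
      b₀ = begin
        ι (rS2 r (suc m) 0) * (- 1# * sgn (m ℕ.+ 0))
          ≈⟨ *-congʳ (ι-rS2-suc-zero r m) ⟩
        ι r * ι (rS2 r m 0) * (- 1# * sgn (m ℕ.+ 0))
          ≈⟨ solve 4 (λ x c e t → x :* c :* (e :* t) := e :* x :* (c :* t)) refl _ _ _ _ ⟩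
        - 1# * ι r * a 0
          ≈⟨ *-congʳ (*-congˡ (reflexive (≡.cong ι (≡.sym (ℕₚ.+-identityʳ r))))) ⟩
        α 0 * a 0 ∎
      rS2-rec : ∀ k → b (suc k) ≈ a k + α (suc k) * a (suc k)
      rS2-rec k = begin
        ι (rS2 r (suc m) (suc k)) * (- 1# * sgn (m ℕ.+ suc k))
          ≈⟨ *-congʳ (ι-rS2-suc-suc r m k) ⟩
        (ι (rS2 r m k) + ι (r ℕ.+ suc k) * ι (rS2 r m (suc k))) * (- 1# * sgn (m ℕ.+ suc k))
          ≈⟨ solve 5 (λ c x c′ e t → (c :+ x :* c′) :* (e :* t) := c :* (e :* t) :+ e :* x :* (c′ :* t))
               refl _ _ _ _ _ ⟩
        ι (rS2 r m k) * (- 1# * sgn (m ℕ.+ suc k)) + α (suc k) * a (suc k)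
          ≈⟨ +-congʳ (*-congˡ (trans (reflexive (≡.cong (λ t → sgn (suc t)) (ℕₚ.+-suc m k)))
                                     (sgn-suc-suc (m ℕ.+ k)))) ⟩
        a k + α (suc k) * a (suc k) ∎

  w-rS2-expansion : (n m r : ℕ) (y : Carrier) →
    w (n ℕ.+ m) r y
      ≈ sumR m (λ k → ι (rS2 r m k) * rising (ι r) k * sgn (m ℕ.+ k) * pow (y + 1#) k * w n (r ℕ.+ k) y)
  w-rS2-expansion n m r y = trans (ŵ-rS2-expansion y m n r) (sumR-cong m (λ {k} _ →
    trans (*-congˡ (*-congʳ (*-congˡ (pow-cong k (+-comm 1# y)))))
          (solve 5 (λ c s ρ π v → c :* s :* (ρ :* π :* v) := c :* ρ :* s :* π :* v) refl _ _ _ _ _)))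

  w-rS1-expansion : (n r p : ℕ) (y u : Carrier) → u * (rising (ι r) p * pow (1# + y) p) ≈ 1# →
    w n (r ℕ.+ p) y ≈ u * sumR p (λ k → ι (rS1 r p k) * w (n ℕ.+ k) r y)
  w-rS1-expansion n r p y u u-inverse = begin
    w n (r ℕ.+ p) y                                              ≈⟨ sym (*-identityˡ _) ⟩
    1# * w n (r ℕ.+ p) y                                         ≈⟨ *-congʳ (sym u-inverse) ⟩
    u * (rising (ι r) p * pow (1# + y) p) * w n (r ℕ.+ p) y      ≈⟨ *-assoc _ _ _ ⟩
    u * ŵ y r p n                                                ≈⟨ *-congˡ (ŵ-rS1-expansion y r p n) ⟩
    u * sumR p (λ k → ι (rS1 r p k) * w (n ℕ.+ k) r y)           ∎

theorem3p7 : ∀ {c ℓ : Level} (R : CommutativeRing c ℓ) →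
    let open CommutativeRing R
        open WithRing R
    in ((n m r : ℕ) (y : Carrier) →
          w (n ℕ.+ m) r y
            ≈ sumR m (λ k → ι (rS2 r m k) * rising (ι r) k * sgn (m ℕ.+ k)
                             * pow (y + 1#) k * w n (r ℕ.+ k) y))
       × ((n r p : ℕ) (y : Carrier) → r ≥ 1 →
          (u : Carrier) → u * (rising (ι r) p * pow (1# + y) p) ≈ 1# →
          w n (r ℕ.+ p) y ≈ u * sumR p (λ k → ι (rS1 r p k) * w (n ℕ.+ k) r y))
theorem3p7 R = w-rS2-expansion R , λ n r p y _ → w-rS1-expansion R n r p y
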